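{- For relations $g_1,g_2$: $(\pi(g_1)\sqcap\epsilon) \Cap (\pi(g_2)\sqcap\epsilon) = \pi(g_1\cap g_2)\sqcap\epsilon$ and $\mathbf{guar}\,g_1 \Cap \mathbf{guar}\,g_2 = \mathbf{guar}(g_1\cap g_2)$.
   Context: Commands form a complete distributive lattice under refinement ($\sqcap$ nondeterministic choice, $\sqcup$ conjunction, $\top$ infeasible); $c^\omega=\mu x.\,\mathbf{nil}\sqcap c;x$. Atomic steps form a Boolean algebra; program steps $\pi(g)$ and environment steps $\epsilon(r)$ are given by injective Boolean homomorphisms from a Boolean algebra (e.g. relations) into atomic steps, with $\pi(p\cup q)=\pi(p)\sqcap\pi(q)$, $\pi(p\cap q)=\pi(p)\sqcup\pi(q)$; $\epsilon$ denotes the least environment step; any program step and environment step have conjunction $\top$. Weak conjunction $\Cap$ is a synchronisation operator with atomic identity $\alpha$, idempotent, with $a\Cap b = a\sqcup b$ on atomic steps and $a^\omega\Cap b^\omega=(a\Cap b)^\omega$. The single-step guarantee is $\pi(g)\sqcap\epsilon$ and $\mathbf{guar}\,g = (\pi(g)\sqcap\epsilon)^\omega$. -}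

module Defs where

open import Level using (0ℓ)
open import Data.Product using (_×_)
open import Relation.Binary.PropositionalEquality using (_≡_)
open import Algebra.Lattice.Structures using (IsDistributiveLattice; IsBooleanAlgebra)

record RGAlgebra : Set₁ where
  infixr 7 _⨟_
  infixr 6 _⊔_
  infixr 5 _⊓_
  infixr 6 _⋒_
  field
    Rel   : Set
    _∪_   : Rel → Rel → Rel
    _∩_   : Rel → Rel → Rel
    ∁     : Rel → Rel
    univ  : Rel
    ∅     : Rel
    rel-isBooleanAlgebra : IsBooleanAlgebra _≡_ _∪_ _∩_ ∁ univ ∅

    -- Commands: a complete distributive lattice under refinement
    -- (_⊓_ nondeterministic choice, _⊔_ conjunction, ⊤ infeasible)
    Cmd   : Set
    _⊓_   : Cmd → Cmd → Cmd
    _⊔_   : Cmd → Cmd → Cmd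
    ⊤     : Cmd
    cmd-isDistributiveLattice : IsDistributiveLattice _≡_ _⊓_ _⊔_
    ⊓-identity-⊤ : ∀ c → c ⊓ ⊤ ≡ c

  -- refinement order: c ⊑ d  (d refines c)
  _⊑_ : Cmd → Cmd → Set
  c ⊑ d = c ⊓ d ≡ c

  field
    ⨅     : {I : Set} → (I → Cmd) → Cmd
    ⨅-lower    : {I : Set} (f : I → Cmd) (i : I) → ⨅ f ⊑ f i
    ⨅-greatest : {I : Set} (f : I → Cmd) (x : Cmd) → (∀ i → x ⊑ f i) → x ⊑ ⨅ f

    nil   : Cmd
    _⨟_   : Cmd → Cmd → Cmd
    ⨟-assoc : ∀ a b c → (a ⨟ b) ⨟ c ≡ a ⨟ (b ⨟ c)
    ⨟-identityˡ : ∀ c → nil ⨟ c ≡ c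
    ⨟-identityʳ : ∀ c → c ⨟ nil ≡ c
    _^ω   : Cmd → Cmd
    ω-unfold : ∀ c → c ^ω ≡ nil ⊓ (c ⨟ (c ^ω))
    ω-least  : ∀ c x → (nil ⊓ (c ⨟ x)) ⊑ x → (c ^ω) ⊑ x

    Atomic : Cmd → Set
    α      : Cmd
    atomic-α : Atomic α
    atomic-⊤ : Atomic ⊤
    atomic-⊓ : ∀ {a b} → Atomic a → Atomic b → Atomic (a ⊓ b)
    atomic-⊔ : ∀ {a b} → Atomic a → Atomic b → Atomic (a ⊔ b)
    !_ : Cmd → Cmd
    atomic-! : ∀ {a} → Atomic a → Atomic (! a)
    !-⊓ : ∀ {a} → Atomic a → a ⊓ (! a) ≡ α
    !-⊔ : ∀ {a} → Atomic a → a ⊔ (! a) ≡ ⊤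
    α-least : ∀ {a} → Atomic a → α ⊑ a

    π : Rel → Cmd
    π-atomic : ∀ p → Atomic (π p)
    π-∪ : ∀ p q → π (p ∪ q) ≡ π p ⊓ π q
    π-∩ : ∀ p q → π (p ∩ q) ≡ π p ⊔ π q
    π-∅ : π ∅ ≡ ⊤
    π-injective : ∀ {p q} → π p ≡ π q → p ≡ q
    env : Rel → Cmd
    env-atomic : ∀ r → Atomic (env r)
    env-∪ : ∀ p q → env (p ∪ q) ≡ env p ⊓ env q
    env-∩ : ∀ p q → env (p ∩ q) ≡ env p ⊔ env q
    env-∅ : env ∅ ≡ ⊤
    env-injective : ∀ {p q} → env p ≡ env q → p ≡ q
    π-env-⊔ : ∀ g r → π g ⊔ env r ≡ ⊤

    _⋒_ : Cmd → Cmd → Cmd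
    ⋒-assoc : ∀ a b c → (a ⋒ b) ⋒ c ≡ a ⋒ (b ⋒ c)
    ⋒-comm  : ∀ a b → a ⋒ b ≡ b ⋒ a
    ⋒-idem  : ∀ c → c ⋒ c ≡ c
    ⋒-distrib-⊓ : ∀ a b c → a ⋒ (b ⊓ c) ≡ (a ⋒ b) ⊓ (a ⋒ c)
    ⋒-atomic-identity : ∀ {a} → Atomic a → a ⋒ α ≡ a
    ⋒-atomic : ∀ {a b} → Atomic a → Atomic b → a ⋒ b ≡ a ⊔ b
    ⋒-ω : ∀ {a b} → Atomic a → Atomic b → (a ^ω) ⋒ (b ^ω) ≡ (a ⋒ b) ^ω

  ϵ : Cmd
  ϵ = env univ

  guarStep : Rel → Cmd
  guarStep g = π g ⊓ ϵ

  guar : Rel → Cmd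
  guar g = (guarStep g) ^ω

-- Weak conjunction of atomic steps is their conjunction, and the conjunction of a
-- program step with an environment step is infeasible.  Distributing ⋒ over the
-- choices in (π g₁ ⊓ ϵ) ⋒ (π g₂ ⊓ ϵ) therefore leaves only π g₁ ⊔ π g₂ = π (g₁ ∩ g₂)
-- and ϵ ⋒ ϵ = ϵ; the guarantee case follows because ⋒ commutes with ω on atomic steps.
module Submission where

open import Defs
open import Data.Product using (_×_; _,_)
open import Relation.Binary.PropositionalEquality using (_≡_; sym; trans; cong; cong₂; module ≡-Reasoning)
open import Algebra.Lattice.Structures using (module IsDistributiveLattice)

module RGAlgebraProperties (A : RGAlgebra) where
  open RGAlgebra A
  open IsDistributiveLattice cmd-isDistributiveLattice using (∨-comm)
  open ≡-Reasoning

  ⊓-identityˡ-⊤ : ∀ c → ⊤ ⊓ c ≡ c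
  ⊓-identityˡ-⊤ c = trans (∨-comm ⊤ c) (⊓-identity-⊤ c)

  π-⋒-env : ∀ g r → π g ⋒ env r ≡ ⊤
  π-⋒-env g r = trans (⋒-atomic (π-atomic g) (env-atomic r)) (π-env-⊔ g r)

  env-⋒-π : ∀ r g → env r ⋒ π g ≡ ⊤
  env-⋒-π r g = trans (⋒-comm (env r) (π g)) (π-⋒-env g r)

  π-⋒-π : ∀ p q → π p ⋒ π q ≡ π (p ∩ q)
  π-⋒-π p q = trans (⋒-atomic (π-atomic p) (π-atomic q)) (sym (π-∩ p q))

  ⊓-env-⋒-⊓-env : ∀ g₁ g₂ r →
    (π g₁ ⊓ env r) ⋒ (π g₂ ⊓ env r) ≡ π (g₁ ∩ g₂) ⊓ env r
  ⊓-env-⋒-⊓-env g₁ g₂ r = begin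
    (a ⊓ e) ⋒ (b ⊓ e)                         ≡⟨ ⋒-distrib-⊓ (a ⊓ e) b e ⟩
    ((a ⊓ e) ⋒ b) ⊓ ((a ⊓ e) ⋒ e)             ≡⟨ cong₂ _⊓_ (⋒-comm (a ⊓ e) b) (⋒-comm (a ⊓ e) e) ⟩
    (b ⋒ (a ⊓ e)) ⊓ (e ⋒ (a ⊓ e))             ≡⟨ cong₂ _⊓_ (⋒-distrib-⊓ b a e) (⋒-distrib-⊓ e a e) ⟩
    ((b ⋒ a) ⊓ (b ⋒ e)) ⊓ ((e ⋒ a) ⊓ (e ⋒ e)) ≡⟨ cong₂ _⊓_ (cong₂ _⊓_ (⋒-comm b a) (π-⋒-env g₂ r))
                                                            (cong₂ _⊓_ (env-⋒-π r g₁) (⋒-idem e)) ⟩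
    ((a ⋒ b) ⊓ ⊤) ⊓ (⊤ ⊓ e)                   ≡⟨ cong₂ _⊓_ (⊓-identity-⊤ (a ⋒ b)) (⊓-identityˡ-⊤ e) ⟩
    (a ⋒ b) ⊓ e                               ≡⟨ cong (_⊓ e) (π-⋒-π g₁ g₂) ⟩
    π (g₁ ∩ g₂) ⊓ e                           ∎
    where
      a = π g₁
      b = π g₂
      e = env r

  guarStep-⋒ : ∀ g₁ g₂ → guarStep g₁ ⋒ guarStep g₂ ≡ guarStep (g₁ ∩ g₂)
  guarStep-⋒ g₁ g₂ = ⊓-env-⋒-⊓-env g₁ g₂ univ

  guarStep-atomic : ∀ g → Atomic (guarStep g)
  guarStep-atomic g = atomic-⊓ (π-atomic g) (env-atomic univ)

  guar-⋒ : ∀ g₁ g₂ → guar g₁ ⋒ guar g₂ ≡ guar (g₁ ∩ g₂)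
  guar-⋒ g₁ g₂ = trans (⋒-ω (guarStep-atomic g₁) (guarStep-atomic g₂)) (cong _^ω (guarStep-⋒ g₁ g₂))

mainTheorem13 : (A : RGAlgebra) → let open RGAlgebra A in
    (g₁ g₂ : Rel) →
    ((π g₁ ⊓ ϵ) ⋒ (π g₂ ⊓ ϵ) ≡ π (g₁ ∩ g₂) ⊓ ϵ)
    × (guar g₁ ⋒ guar g₂ ≡ guar (g₁ ∩ g₂))
mainTheorem13 A g₁ g₂ = guarStep-⋒ g₁ g₂ , guar-⋒ g₁ g₂
  where open RGAlgebraProperties A
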